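{- Let $k\ge 2$. For each vertex $v\in\{0,\ldots,n-1\}^k$ let $F(v)=\{y\in\{0,\ldots,n-1\}^k:\exists\mathbf{s}\in\Psi,\ j\in\{0,\ldots,k(n-1)\}\text{ with }h^{\mathbf{s},j}(v)=y\}$. Then $|F(v)|\le k^3$.
   Context: Fix positive integers $n,k,L,\rho$ with $\rho\mid k(n-1)$, $k\mid\rho$, $\rho\ge 12kL$. Order $\{0,\ldots,n-1\}^k$ componentwise; $wt(x)=\sum_i x_i$. Tube: $T_L=\{x:\exists i\in\{0,\ldots,n-1\},|x_c-i|\le L\ \forall c\}$. $\mathcal{I}=\{a\in\{0,\ldots,k(n-1)\}:\rho\mid a\}$, $Low_a=\{x\in T_L:wt(x)=a\}$. $\mathcal{C}(w)$ is the closed unit cube centered at $w$, $\ell(u,v)$ the closed segment. A monotone connected path: each vertex is the previous plus a standard unit vector. Given connecting points $\chi_i\in Low_i$ ($i\in\mathcal{I}$), for each consecutive pair $\chi_i,\chi_{i+\rho}$ let $(s^i,\ldots,s^{i+\rho})$ be the lexicographically smallest sequence starting at $\chi_i$, ending at $\chi_{i+\rho}$, forming a monotone connected path, with $\mathcal{C}(s^t)\cap\ell(\chi_i,\chi_{i+\rho})\ne\emptyset$ for every vertex; the induced spine is $(s^0,\ldots,s^{k(n-1)})$; $\Psi$ is the set of all induced spines. For a spine $\mathbf{s}$ and $j$, with $M(v)=\min\{i:s^i\ge v\}$, $\mu(v)=\max\{i:s^i\le v\}$: $h^{\mathbf{s},j}(v)=v$ if $v=s^j$; $s^{i+1}$ if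 $v=s^i,i<j$; $s^{i-1}$ if $v=s^i,i>j$; $v+(s^{\mu(v)+1}-s^{\mu(v)})-(s^{M(v)}-s^{M(v)-1})$ otherwise. -}

module Defs where

open import Data.Nat as ℕ using (ℕ; zero; suc; _+_; _*_; _∸_; _≤_; _<_)
open import Data.Nat.Divisibility using (_∣_)
open import Data.Fin using (Fin; toℕ)
open import Data.Vec using (Vec; lookup; sum)
open import Data.Integer as ℤ using (ℤ; +_)
open import Data.Rational as ℚ using (ℚ; ½; 0ℚ; 1ℚ)
open import Data.Product using (Σ; ∃; _×_; _,_)
open import Data.Sum using (_⊎_)
open import Data.List using (List)
open import Relation.Binary.PropositionalEquality using (_≡_; _≢_)
open import Relation.Nullary using (¬_)

Vertex : ℕ → Set
Vertex k = Vec ℕ k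

InGrid : ∀ {k} → ℕ → Vertex k → Set
InGrid n x = ∀ c → lookup x c < n

_≤ᵥ_ : ∀ {k} → Vertex k → Vertex k → Set
x ≤ᵥ y = ∀ c → lookup x c ≤ lookup y c

wt : ∀ {k} → Vertex k → ℕ
wt x = sum x

InTube : ∀ {k} → ℕ → ℕ → Vertex k → Set
InTube n L x = Σ ℕ λ i → i < n × (∀ c → lookup x c ≤ i + L × i ≤ lookup x c + L)

InLow : ∀ {k} → ℕ → ℕ → ℕ → Vertex k → Set
InLow n L a x = InGrid n x × InTube n L x × wt x ≡ a

UnitStep : ∀ {k} → Vertex k → Vertex k → Set
UnitStep {k} x y = Σ (Fin k) λ c →
  lookup y c ≡ suc (lookup x c) × (∀ c' → c' ≢ c → lookup y c' ≡ lookup x c')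

toℚ : ℕ → ℚ
toℚ m = + m ℚ./ 1

-- closed unit cube C(w) (side length 1, centred at w) meets the closed segment ℓ(u,v)
CubeMeetsSeg : ∀ {k} → Vertex k → Vertex k → Vertex k → Set
CubeMeetsSeg w u v = Σ ℚ λ λ' → 0ℚ ℚ.≤ λ' × λ' ℚ.≤ 1ℚ ×
  (∀ c → ℚ.∣ (toℚ (lookup u c) ℚ.+ λ' ℚ.* (toℚ (lookup v c) ℚ.- toℚ (lookup u c)))
             ℚ.- toℚ (lookup w c) ∣ ℚ.≤ ½)

ValidSeq : ∀ {k} → ℕ → Vertex k → Vertex k → (ℕ → Vertex k) → Set
ValidSeq ρ u v t = t 0 ≡ u × t ρ ≡ v ×
  (∀ m → m < ρ → UnitStep (t m) (t (suc m))) ×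
  (∀ m → m ≤ ρ → CubeMeetsSeg (t m) u v)

_<lex_ : ∀ {k} → Vertex k → Vertex k → Set
_<lex_ {k} x y = Σ (Fin k) λ c →
  (∀ c' → toℕ c' ℕ.< toℕ c → lookup x c' ≡ lookup y c') × lookup x c < lookup y c

SeqLexLt : ∀ {k} → ℕ → (ℕ → Vertex k) → (ℕ → Vertex k) → Set
SeqLexLt ρ t t' = Σ ℕ λ m → m ≤ ρ × (∀ m' → m' < m → t m' ≡ t' m') × (t m <lex t' m)

SeqLexLe : ∀ {k} → ℕ → (ℕ → Vertex k) → (ℕ → Vertex k) → Set
SeqLexLe ρ t t' = (∀ m → m ≤ ρ → t m ≡ t' m) ⊎ SeqLexLt ρ t t'

LexMinSeq : ∀ {k} → ℕ → Vertex k → Vertex k → (ℕ → Vertex k) → Set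
LexMinSeq {k} ρ u v t = ValidSeq ρ u v t × (∀ (t' : ℕ → Vertex k) → ValidSeq ρ u v t' → SeqLexLe ρ t t')

-- s (indices 0 … k(n-1)) is an induced spine, i.e. s ∈ Ψ
IsSpine : (n k L ρ : ℕ) → (ℕ → Vertex k) → Set
IsSpine n k L ρ s = Σ (ℕ → Vertex k) λ χ →
  (∀ a → a ≤ k * (n ∸ 1) → ρ ∣ a → InLow n L a (χ a)) ×
  (∀ a → ρ ∣ a → a + ρ ≤ k * (n ∸ 1) →
     LexMinSeq ρ (χ a) (χ (a + ρ)) (λ m → s (a + m)))

IsM : ∀ {k} → ℕ → (ℕ → Vertex k) → Vertex k → ℕ → Set
IsM K s v M = M ≤ K × v ≤ᵥ s M × (∀ i → i < M → ¬ (v ≤ᵥ s i))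

Isμ : ∀ {k} → ℕ → (ℕ → Vertex k) → Vertex k → ℕ → Set
Isμ K s v μ = μ ≤ K × s μ ≤ᵥ v × (∀ i → μ < i → i ≤ K → ¬ (s i ≤ᵥ v))

ℤc : ∀ {k} → Vertex k → Fin k → ℤ
ℤc x c = + (lookup x c)

-- h^{s,j}(v) = y, following the four cases of the definition (K = k(n-1))
HRel : ∀ {k} → ℕ → (ℕ → Vertex k) → ℕ → Vertex k → Vertex k → Set
HRel {k} K s j v y =
  (v ≡ s j × y ≡ v)
  ⊎ (v ≢ s j × Σ ℕ λ i → i < j × v ≡ s i × y ≡ s (suc i))
  ⊎ (v ≢ s j × Σ ℕ λ i → j < i × i ≤ K × v ≡ s i × y ≡ s (i ∸ 1))
  ⊎ ((∀ i → i ≤ K → v ≢ s i) × Σ ℕ λ M → Σ ℕ λ μ → IsM K s v M × Isμ K s v μ ×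
       (∀ c →
              ℤc y c ≡ ℤc v c ℤ.+ (ℤc (s (suc μ)) c ℤ.- ℤc (s μ) c)
                             ℤ.- (ℤc (s M) c ℤ.- ℤc (s (M ∸ 1)) c)))

InF : (n k L ρ : ℕ) → Vertex k → Vertex k → Set
InF n k L ρ v y = InGrid n y × Σ (ℕ → Vertex k) λ s → IsSpine n k L ρ s ×
  Σ ℕ λ j → j ≤ k * (n ∸ 1) × HRel (k * (n ∸ 1)) s j v y

-- Consecutive vertices of a spine differ by a standard unit vector, since a spine is
-- glued together from monotone connected paths. Hence h^{s,j} moves v to v itself, to
-- a neighbour s^{i±1} = v ± e_a of v on the spine, or (off the spine) to
-- v + (s^{μ+1} − s^μ) − (s^M − s^{M−1}) = v + e_a − e_b. There are at most
-- k² + 2k ≤ k³ such vertices, and a duplicate-free list of them is no longer.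
module Submission where

open import Defs
open import Data.Nat using (ℕ; _*_; _∸_; _≤_; _<_; _^_)
open import Data.Nat.Divisibility using (_∣_)
open import Data.List using (List; length)
open import Data.List.Relation.Unary.All using (All)
open import Data.List.Relation.Unary.Unique.Propositional using (Unique)

open import Data.Nat using (zero; suc; _+_; NonZero; >-nonZero; _≤′_; ≤′-refl; ≤′-step)
open import Data.Nat.Properties
  using ( ≤-refl; ≤-trans; ≤-antisym; <⇒≤; ≤-<-trans; <-≤-trans; ≰⇒>; ≤⇒≤′; module ≤-Reasoning
        ; +-comm; +-suc; +-identityʳ; *-identityʳ; *-distribˡ-+; m≤m+n; +-monoʳ-≤; *-monoˡ-≤; *-monoʳ-≤
        ; m+n∸n≡m; m+[n∸m]≡n; m<n⇒0<n∸m )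
open import Data.Nat.Divisibility using (∣⇒≤; ∣m+n∣m⇒∣n; n∣m*n)
open import Data.Nat.DivMod using (_/_; _%_; m≡m%n+[m/n]*n; m%n<n)
open import Data.Fin using (Fin; zero; suc; fromℕ<; _≟_)
open import Data.Fin.Properties using (injective⇒≤)
open import Data.Vec using (lookup; tabulate)
open import Data.Vec.Properties using (lookup∘tabulate)
open import Data.Vec.Relation.Binary.Pointwise.Extensional using (ext; Pointwise-≡⇒≡)
open import Data.Integer as ℤ using (+_)
import Data.Integer.Properties as ℤᴾ
open import Algebra.Properties.AbelianGroup ℤᴾ.+-0-abelianGroup using (//-rightDividesˡ; //-rightDividesʳ)
open import Data.List as List using (_++_; map; allFin; cartesianProductWith)
open import Data.List.Properties using (length-++; length-map; length-tabulate)
open import Data.List.Membership.Propositional using (_∈_)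
open import Data.List.Membership.Propositional.Properties
  using (∈-lookup; ∈-allFin; ∈-map⁺; ∈-++⁺ˡ; ∈-++⁺ʳ; ∈-cartesianProductWith⁺)
open import Data.List.Relation.Binary.Subset.Propositional using (_⊆_)
open import Data.List.Relation.Unary.Any using (index)
open import Data.List.Relation.Unary.Any.Properties using (lookup-index)
import Data.List.Relation.Unary.All as All
open import Data.List.Relation.Unary.AllPairs using (_∷_)
open import Data.Product using (∃; _,_; proj₂)
open import Data.Sum using (inj₁; inj₂)
open import Function.Definitions using (Injective)
open import Relation.Nullary using (yes; no; contradiction)
open import Relation.Binary.PropositionalEquality

module _ {A : Set} where

  Unique-lookup-injective : ∀ {xs : List A} → Unique xs →
                            ∀ i j → List.lookup xs i ≡ List.lookup xs j → i ≡ j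
  Unique-lookup-injective (_ ∷ _) zero zero _ = refl
  Unique-lookup-injective (x∉ ∷ _) zero (suc j) eq = contradiction eq (All.lookup x∉ (∈-lookup j))
  Unique-lookup-injective (x∉ ∷ _) (suc i) zero eq = contradiction (sym eq) (All.lookup x∉ (∈-lookup i))
  Unique-lookup-injective (_ ∷ u) (suc i) (suc j) eq = cong suc (Unique-lookup-injective u i j eq)

  Unique⇒length≤ : ∀ {xs ys : List A} → Unique xs → xs ⊆ ys → length xs ≤ length ys
  Unique⇒length≤ {xs} {ys} unique xs⊆ys = injective⇒≤ position-injective
    where
    position : Fin (length xs) → Fin (length ys)
    position i = index (xs⊆ys (∈-lookup i))

    position-injective : Injective _≡_ _≡_ position
    position-injective {i} {j} eq = Unique-lookup-injective unique i j (begin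
      List.lookup xs i            ≡⟨ lookup-index (xs⊆ys (∈-lookup i)) ⟩
      List.lookup ys (position i) ≡⟨ cong (List.lookup ys) eq ⟩
      List.lookup ys (position j) ≡⟨ lookup-index (xs⊆ys (∈-lookup j)) ⟨
      List.lookup xs j            ∎)
      where open ≡-Reasoning

length-cartesianProductWith : ∀ {A B C : Set} (f : A → B → C) xs ys →
                              length (cartesianProductWith f xs ys) ≡ length xs * length ys
length-cartesianProductWith f List.[] ys = refl
length-cartesianProductWith f (x List.∷ xs) ys = begin
  length (map (f x) ys ++ cartesianProductWith f xs ys)   ≡⟨ length-++ (map (f x) ys) ⟩
  length (map (f x) ys) + length (cartesianProductWith f xs ys)
    ≡⟨ cong₂ _+_ (length-map (f x) ys) (length-cartesianProductWith f xs ys) ⟩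
  length ys + length xs * length ys                       ∎
  where open ≡-Reasoning

length-allFin : ∀ k → length (allFin k) ≡ k
length-allFin k = length-tabulate (λ a → a)

next-multiple-≤ : ∀ {d m n} → d ∣ m → d ∣ n → m < n → m + d ≤ n
next-multiple-≤ {d} {m} {n} d∣m d∣n m<n = begin
  m + d       ≤⟨ +-monoʳ-≤ m (∣⇒≤ {{>-nonZero (m<n⇒0<n∸m m<n)}} d∣n∸m) ⟩
  m + (n ∸ m) ≡⟨ m+[n∸m]≡n (<⇒≤ m<n) ⟩
  n           ∎
  where
  open ≤-Reasoning
  d∣n∸m : d ∣ n ∸ m
  d∣n∸m = ∣m+n∣m⇒∣n (subst (d ∣_) (sym (m+[n∸m]≡n (<⇒≤ m<n))) d∣n) d∣m

square+double≤cube : ∀ {k} → 2 ≤ k → k * k + (k + k) ≤ k ^ 3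
square+double≤cube {k} 2≤k = begin
  k * k + (k + k) ≤⟨ +-monoʳ-≤ (k * k) double≤square ⟩
  k * k + k * k   ≡⟨ *-distribˡ-+ k k k ⟨
  k * (k + k)     ≤⟨ *-monoʳ-≤ k double≤square ⟩
  k * (k * k)     ≡⟨ cong (λ m → k * (k * m)) (*-identityʳ k) ⟨
  k ^ 3           ∎
  where
  open ≤-Reasoning
  double≤square : k + k ≤ k * k
  double≤square = subst (_≤ k * k) (cong (λ m → k + m) (+-identityʳ k)) (*-monoˡ-≤ k 2≤k)

module _ {k : ℕ} where

  vertex-ext : {x y : Vertex k} → (∀ c → lookup x c ≡ lookup y c) → x ≡ y
  vertex-ext eq = Pointwise-≡⇒≡ (ext eq)

  ≤ᵥ-refl : {x : Vertex k} → x ≤ᵥ x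
  ≤ᵥ-refl c = ≤-refl

  ≤ᵥ-trans : {x y z : Vertex k} → x ≤ᵥ y → y ≤ᵥ z → x ≤ᵥ z
  ≤ᵥ-trans x≤y y≤z c = ≤-trans (x≤y c) (y≤z c)

  ≤ᵥ-antisym : {x y : Vertex k} → x ≤ᵥ y → y ≤ᵥ x → x ≡ y
  ≤ᵥ-antisym x≤y y≤x = vertex-ext λ c → ≤-antisym (x≤y c) (y≤x c)

  δ : Fin k → Fin k → ℕ
  δ a c with c ≟ a
  ... | yes _ = 1
  ... | no _ = 0

  infixl 6 _+ₑ_ _∸ₑ_

  _+ₑ_ : Vertex k → Fin k → Vertex k
  v +ₑ a = tabulate λ c → lookup v c + δ a c

  _∸ₑ_ : Vertex k → Fin k → Vertex k
  v ∸ₑ a = tabulate λ c → lookup v c ∸ δ a c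

  lookup-+ₑ : ∀ v a c → lookup (v +ₑ a) c ≡ lookup v c + δ a c
  lookup-+ₑ v a = lookup∘tabulate (λ c → lookup v c + δ a c)

  lookup-∸ₑ : ∀ v a c → lookup (v ∸ₑ a) c ≡ lookup v c ∸ δ a c
  lookup-∸ₑ v a = lookup∘tabulate (λ c → lookup v c ∸ δ a c)

  +ₑ-∸ₑ-cancel : ∀ v a → v +ₑ a ∸ₑ a ≡ v
  +ₑ-∸ₑ-cancel v a = vertex-ext λ c → begin
    lookup (v +ₑ a ∸ₑ a) c        ≡⟨ lookup-∸ₑ (v +ₑ a) a c ⟩
    lookup (v +ₑ a) c ∸ δ a c     ≡⟨ cong (_∸ δ a c) (lookup-+ₑ v a c) ⟩
    lookup v c + δ a c ∸ δ a c    ≡⟨ m+n∸n≡m (lookup v c) (δ a c) ⟩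
    lookup v c                    ∎
    where open ≡-Reasoning

  UnitStep⇒+ₑ : {x y : Vertex k} → UnitStep x y → ∃ λ a → y ≡ x +ₑ a
  UnitStep⇒+ₑ {x} {y} (a , y[a] , y[c]) = a , vertex-ext λ c →
    trans (coordinate c) (sym (lookup-+ₑ x a c))
    where
    coordinate : ∀ c → lookup y c ≡ lookup x c + δ a c
    coordinate c with c ≟ a
    ... | yes refl = trans y[a] (+-comm 1 (lookup x c))
    ... | no c≢a = trans (y[c] c c≢a) (sym (+-identityʳ (lookup x c)))

  ≤ᵥ-+ₑ : ∀ x a → x ≤ᵥ (x +ₑ a)
  ≤ᵥ-+ₑ x a c = subst (lookup x c ≤_) (sym (lookup-+ₑ x a c)) (m≤m+n (lookup x c) (δ a c))

  +ₑ-difference : ∀ x a c → ℤc (x +ₑ a) c ℤ.- ℤc x c ≡ + δ a c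
  +ₑ-difference x a c = begin
    + lookup (x +ₑ a) c ℤ.- + lookup x c   ≡⟨ cong (λ m → + m ℤ.- + lookup x c) (lookup-+ₑ x a c) ⟩
    + (lookup x c + δ a c) ℤ.- + lookup x c ≡⟨ cong (λ m → + m ℤ.- + lookup x c) (+-comm (lookup x c) (δ a c)) ⟩
    + (δ a c + lookup x c) ℤ.- + lookup x c ≡⟨ //-rightDividesʳ (+ lookup x c) (+ δ a c) ⟩
    + δ a c                                ∎
    where open ≡-Reasoning

  +≡+-+⇒≡∸ : ∀ {y m d} → + y ≡ + m ℤ.- + d → y ≡ m ∸ d
  +≡+-+⇒≡∸ {y} {m} {d} eq = begin
    y           ≡⟨ m+n∸n≡m y d ⟨
    y + d ∸ d   ≡⟨ cong (_∸ d) (ℤᴾ.+-injective y+d≡m) ⟩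
    m ∸ d       ∎
    where
    open ≡-Reasoning
    y+d≡m : + (y + d) ≡ + m
    y+d≡m = trans (cong (ℤ._+ + d) eq) (//-rightDividesˡ (+ d) (+ m))

  -- The off-spine case of h^{s,j}, with s^{μ+1} = x +ₑ a and s^M = z +ₑ b.
  displaced-by-unit-vectors : ∀ {v y x x′ z z′ : Vertex k} {a b} → x′ ≡ x +ₑ a → z′ ≡ z +ₑ b →
    (∀ c → ℤc y c ≡ ℤc v c ℤ.+ (ℤc x′ c ℤ.- ℤc x c) ℤ.- (ℤc z′ c ℤ.- ℤc z c)) →
    y ≡ v +ₑ a ∸ₑ b
  displaced-by-unit-vectors {v} {y} {x} {z = z} {a = a} {b} refl refl eq = vertex-ext λ c → begin
    lookup y c                        ≡⟨ +≡+-+⇒≡∸ {m = lookup v c + δ a c} {δ b c} (trans (eq c)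
                                           (cong₂ (λ p q → ℤc v c ℤ.+ p ℤ.- q)
                                                  (+ₑ-difference x a c) (+ₑ-difference z b c))) ⟩
    lookup v c + δ a c ∸ δ b c        ≡⟨ cong (_∸ δ b c) (lookup-+ₑ v a c) ⟨
    lookup (v +ₑ a) c ∸ δ b c         ≡⟨ lookup-∸ₑ (v +ₑ a) b c ⟨
    lookup (v +ₑ a ∸ₑ b) c            ∎
    where open ≡-Reasoning

  unitShifts : Vertex k → List (Vertex k)
  unitShifts v = cartesianProductWith (λ a b → v +ₑ a ∸ₑ b) (allFin k) (allFin k)
              ++ map (v +ₑ_) (allFin k) ++ map (v ∸ₑ_) (allFin k)

  length-unitShifts : ∀ v → length (unitShifts v) ≡ k * k + (k + k)
  length-unitShifts v = begin
    length (unitShifts v)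
      ≡⟨ length-++ pairs ⟩
    length pairs + length (map (v +ₑ_) (allFin k) ++ map (v ∸ₑ_) (allFin k))
      ≡⟨ cong (λ m → length pairs + m) (length-++ (map (v +ₑ_) (allFin k))) ⟩
    length pairs + (length (map (v +ₑ_) (allFin k)) + length (map (v ∸ₑ_) (allFin k)))
      ≡⟨ cong₂ _+_ (length-cartesianProductWith _ (allFin k) (allFin k))
                   (cong₂ _+_ (length-map (v +ₑ_) (allFin k)) (length-map (v ∸ₑ_) (allFin k))) ⟩
    length (allFin k) * length (allFin k) + (length (allFin k) + length (allFin k))
      ≡⟨ cong (λ m → m * m + (m + m)) (length-allFin k) ⟩
    k * k + (k + k)
      ∎
    where
    open ≡-Reasoning
    pairs = cartesianProductWith (λ a b → v +ₑ a ∸ₑ b) (allFin k) (allFin k)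

  +ₑ∸ₑ∈unitShifts : ∀ {y} v a b → y ≡ v +ₑ a ∸ₑ b → y ∈ unitShifts v
  +ₑ∸ₑ∈unitShifts v a b refl =
    ∈-++⁺ˡ (∈-cartesianProductWith⁺ (λ a b → v +ₑ a ∸ₑ b) (∈-allFin a) (∈-allFin b))

  +ₑ∈unitShifts : ∀ {y} v a → y ≡ v +ₑ a → y ∈ unitShifts v
  +ₑ∈unitShifts v a refl =
    ∈-++⁺ʳ (cartesianProductWith _ (allFin k) (allFin k)) (∈-++⁺ˡ (∈-map⁺ (v +ₑ_) (∈-allFin a)))

  ∸ₑ∈unitShifts : ∀ {v} y a → v ≡ y +ₑ a → y ∈ unitShifts v
  ∸ₑ∈unitShifts y a refl = subst (_∈ unitShifts (y +ₑ a)) (+ₑ-∸ₑ-cancel y a)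
    (∈-++⁺ʳ (cartesianProductWith _ (allFin k) (allFin k))
      (∈-++⁺ʳ (map ((y +ₑ a) +ₑ_) (allFin k)) (∈-map⁺ ((y +ₑ a) ∸ₑ_) (∈-allFin a))))

  ∈unitShifts-self : ∀ v → Fin k → v ∈ unitShifts v
  ∈unitShifts-self v a = +ₑ∸ₑ∈unitShifts v a a (sym (+ₑ-∸ₑ-cancel v a))

module Spine {n k L ρ : ℕ} .{{_ : NonZero ρ}} (ρ∣K : ρ ∣ k * (n ∸ 1))
             {s : ℕ → Vertex k} (spine : IsSpine n k L ρ s) where

  private
    K : ℕ
    K = k * (n ∸ 1)

  block-steps : ∀ {a} → ρ ∣ a → a + ρ ≤ K → ∀ m → m < ρ → UnitStep (s (a + m)) (s (a + suc m))
  block-steps {a} ρ∣a a+ρ≤K with proj₂ (proj₂ spine) a ρ∣a a+ρ≤K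
  ... | (_ , _ , steps , _) , _ = steps

  -- Step i lies in the block starting at the multiple ⌊i/ρ⌋ρ of ρ.
  spine-step : ∀ {i} → i < K → UnitStep (s i) (s (suc i))
  spine-step {i} i<K = subst₂ (λ p q → UnitStep (s p) (s q)) a+m≡i (trans (+-suc a m) (cong suc a+m≡i))
    (block-steps ρ∣a (next-multiple-≤ ρ∣a ρ∣K a<K) m (m%n<n i ρ))
    where
    a m : ℕ
    a = i / ρ * ρ
    m = i % ρ
    ρ∣a : ρ ∣ a
    ρ∣a = n∣m*n (i / ρ)
    a+m≡i : a + m ≡ i
    a+m≡i = trans (+-comm a m) (sym (m≡m%n+[m/n]*n i ρ))
    a<K : a < K
    a<K = ≤-<-trans (subst (a ≤_) a+m≡i (m≤m+n a m)) i<K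

  spine-+ₑ : ∀ {i} → i < K → ∃ λ a → s (suc i) ≡ s i +ₑ a
  spine-+ₑ {i} i<K = UnitStep⇒+ₑ {x = s i} (spine-step i<K)

  spine-mono′ : ∀ {i j} → i ≤′ j → j ≤ K → s i ≤ᵥ s j
  spine-mono′ {i} ≤′-refl _ = ≤ᵥ-refl {x = s i}
  spine-mono′ {i} {suc j} (≤′-step i≤′j) j<K with a , eq ← spine-+ₑ j<K =
    ≤ᵥ-trans {x = s i} {y = s j} {z = s (suc j)} (spine-mono′ i≤′j (<⇒≤ j<K))
      (subst (s j ≤ᵥ_) (sym eq) (≤ᵥ-+ₑ (s j) a))

  spine-mono : ∀ {i j} → i ≤ j → j ≤ K → s i ≤ᵥ s j
  spine-mono i≤j = spine-mono′ (≤⇒≤′ i≤j)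

  -- If M ≤ μ then s^μ ≤ v ≤ s^M ≤ s^μ would put v on the spine.
  μ<M : ∀ {v M μ} → (∀ i → i ≤ K → v ≢ s i) → IsM K s v M → Isμ K s v μ → μ < M
  μ<M {v} {M} {μ} off (_ , v≤sM , _) (μ≤K , sμ≤v , _) =
    ≰⇒> λ M≤μ → off μ μ≤K
      (≤ᵥ-antisym {x = v} (≤ᵥ-trans {x = v} {y = s M} {z = s μ} v≤sM (spine-mono M≤μ μ≤K)) sμ≤v)

  HRel⇒∈unitShifts : ∀ {j v y} → Fin k → j ≤ K → HRel K s j v y → y ∈ unitShifts v
  HRel⇒∈unitShifts {v = v} a₀ _ (inj₁ (_ , refl)) = ∈unitShifts-self v a₀
  HRel⇒∈unitShifts _ j≤K (inj₂ (inj₁ (_ , i , i<j , refl , refl)))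
    with a , eq ← spine-+ₑ (<-≤-trans i<j j≤K) = +ₑ∈unitShifts (s i) a eq
  HRel⇒∈unitShifts _ _ (inj₂ (inj₂ (inj₁ (_ , suc i , _ , i<K , refl , refl))))
    with a , eq ← spine-+ₑ i<K = ∸ₑ∈unitShifts (s i) a eq
  HRel⇒∈unitShifts _ _ (inj₂ (inj₂ (inj₂ (off , zero , μ , isM , isμ , _))))
    with () ← μ<M off isM isμ
  HRel⇒∈unitShifts {v = v} {y} _ _ (inj₂ (inj₂ (inj₂ (off , suc M , μ , isM@(M<K , _) , isμ , eq))))
    with a , step-μ ← spine-+ₑ (<-≤-trans (μ<M off isM isμ) M<K)
       | b , step-M ← spine-+ₑ M<K =
    +ₑ∸ₑ∈unitShifts v a b (displaced-by-unit-vectors {v = v} {y} {s μ} {z = s M} step-μ step-M eq)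

lemma11 : (n k L ρ : ℕ) → 0 < n → 0 < k → 0 < L → 0 < ρ →
          ρ ∣ k * (n ∸ 1) → k ∣ ρ → 12 * k * L ≤ ρ → 2 ≤ k →
          (v : Vertex k) → InGrid n v →
          (ys : List (Vertex k)) → Unique ys → All (InF n k L ρ v) ys →
          length ys ≤ k ^ 3
lemma11 n k L ρ@(suc _) _ 0<k _ _ ρ∣K _ _ 2≤k v _ ys unique ys⊆F = begin
  length ys              ≤⟨ Unique⇒length≤ unique ys⊆unitShifts ⟩
  length (unitShifts v)  ≡⟨ length-unitShifts v ⟩
  k * k + (k + k)        ≤⟨ square+double≤cube 2≤k ⟩
  k ^ 3                  ∎
  where
  open ≤-Reasoning
  ys⊆unitShifts : ys ⊆ unitShifts v
  ys⊆unitShifts y∈ys with _ , _ , spine , _ , j≤K , h ← All.lookup ys⊆F y∈ys =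
    Spine.HRel⇒∈unitShifts ρ∣K spine (fromℕ< 0<k) j≤K h
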